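{- The variety of girales has equationally definable principal congruences.
   Context: A commutative residuated lattice is $\langle A,\vee,\wedge,\to,\cdot,1\rangle$ with $\langle A,\vee,\wedge\rangle$ a lattice, $\langle A,\cdot,1\rangle$ a commutative monoid, and $x\cdot y\le z$ iff $x\le y\to z$. A Girard algebra is a commutative residuated lattice with a constant $0$ with $(b\to 0)\to 0=b$ for all $b$; $\neg x:=x\to 0$. A girale is a Girard algebra with a unary operation $!$ satisfying (G1) $!1=1$; (G2) $!a\le a\wedge 1$; (G3) $!a\cdot !b=!(a\wedge b)$; (G4) $!!a=!a$. A variety $\mathcal V$ has equationally definable principal congruences if there are finitely many pairs of 4-ary terms $s_i,t_i$ such that for every $\mathbf A\in\mathcal V$ and $a,b,c,d\in A$: $(c,d)\in\mathrm{Cg}_{\mathbf A}(a,b)$ iff $s_i(a,b,c,d)=t_i(a,b,c,d)$ for all $i$. -}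

module Defs where

open import Level using (Level; suc; _⊔_; Setω)
open import Data.Nat using (ℕ)
open import Data.Fin using (Fin)
open import Data.Product using (_×_)
open import Function.Bundles using (_⇔_)
open import Relation.Binary.PropositionalEquality using (_≡_)
open import Relation.Binary.Core using (Rel)
open import Relation.Binary.Structures using (IsEquivalence)
open import Algebra.Lattice.Structures using (IsLattice)
open import Algebra.Structures using (IsCommutativeMonoid)

infixr 6 _∨_
infixr 7 _∧_
infixr 5 _⇒_
infixl 8 _·_

record Girale (ℓ : Level) : Set (suc ℓ) where
  field
    Carrier : Set ℓ
    _∨_ _∧_ _⇒_ _·_ : Carrier → Carrier → Carrier
    𝟏 𝟎 : Carrier
    ! : Carrier → Carrier

  _≤_ : Carrier → Carrier → Set ℓ
  x ≤ y = x ∧ y ≡ x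

  field
    isLattice : IsLattice _≡_ _∨_ _∧_
    isCommutativeMonoid : IsCommutativeMonoid _≡_ _·_ 𝟏
    residuation : ∀ x y z → ((x · y) ≤ z) ⇔ (x ≤ (y ⇒ z))
    involutive : ∀ b → (b ⇒ 𝟎) ⇒ 𝟎 ≡ b
    G1 : ! 𝟏 ≡ 𝟏
    G2 : ∀ a → ! a ≤ (a ∧ 𝟏)
    G3 : ∀ a b → ! a · ! b ≡ ! (a ∧ b)
    G4 : ∀ a → ! (! a) ≡ ! a

data Term (n : ℕ) : Set where
  var : Fin n → Term n
  _∨_ _∧_ _⇒_ _·_ : Term n → Term n → Term n
  𝟏 𝟎 : Term n
  ! : Term n → Term n

module _ {ℓ : Level} (G : Girale ℓ) where
  open Girale G renaming (_∨_ to _∨ᴳ_; _∧_ to _∧ᴳ_; _⇒_ to _⇒ᴳ_; _·_ to _·ᴳ_;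
                          𝟏 to 𝟏ᴳ; 𝟎 to 𝟎ᴳ; ! to !ᴳ)

  ⟦_⟧ : {n : ℕ} → Term n → (Fin n → Carrier) → Carrier
  ⟦ var i ⟧ ρ = ρ i
  ⟦ s ∨ t ⟧ ρ = ⟦ s ⟧ ρ ∨ᴳ ⟦ t ⟧ ρ
  ⟦ s ∧ t ⟧ ρ = ⟦ s ⟧ ρ ∧ᴳ ⟦ t ⟧ ρ
  ⟦ s ⇒ t ⟧ ρ = ⟦ s ⟧ ρ ⇒ᴳ ⟦ t ⟧ ρ
  ⟦ s · t ⟧ ρ = ⟦ s ⟧ ρ ·ᴳ ⟦ t ⟧ ρ
  ⟦ 𝟏 ⟧ ρ = 𝟏ᴳ
  ⟦ 𝟎 ⟧ ρ = 𝟎ᴳ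
  ⟦ ! t ⟧ ρ = !ᴳ (⟦ t ⟧ ρ)

  record IsCongruence (θ : Rel Carrier ℓ) : Set ℓ where
    field
      isEquivalence : IsEquivalence θ
      ∨-compat : ∀ {x x′ y y′} → θ x x′ → θ y y′ → θ (x ∨ᴳ y) (x′ ∨ᴳ y′)
      ∧-compat : ∀ {x x′ y y′} → θ x x′ → θ y y′ → θ (x ∧ᴳ y) (x′ ∧ᴳ y′)
      ⇒-compat : ∀ {x x′ y y′} → θ x x′ → θ y y′ → θ (x ⇒ᴳ y) (x′ ⇒ᴳ y′)
      ·-compat : ∀ {x x′ y y′} → θ x x′ → θ y y′ → θ (x ·ᴳ y) (x′ ·ᴳ y′)
      !-compat : ∀ {x x′} → θ x x′ → θ (!ᴳ x) (!ᴳ x′)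

  -- (c , d) ∈ Cg(a , b): (c , d) lies in every congruence containing (a , b),
  -- i.e. in the least such congruence.
  InCg : Carrier → Carrier → Carrier → Carrier → Set (suc ℓ)
  InCg a b c d = (θ : Rel Carrier ℓ) → IsCongruence θ → θ a b → θ c d

asg4 : ∀ {a} {A : Set a} → A → A → A → A → Fin 4 → A
asg4 a b c d Fin.zero = a
asg4 a b c d (Fin.suc Fin.zero) = b
asg4 a b c d (Fin.suc (Fin.suc Fin.zero)) = c
asg4 a b c d (Fin.suc (Fin.suc (Fin.suc Fin.zero))) = d

record GiralesHaveEDPC : Setω where
  field
    k : ℕ
    s t : Fin k → Term 4
    defines : ∀ {ℓ} (G : Girale ℓ) (a b c d : Girale.Carrier G) →
      InCg G a b c d ⇔
      ((i : Fin k) → ⟦ G ⟧ (s i) (asg4 a b c d) ≡ ⟦ G ⟧ (t i) (asg4 a b c d))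

{-# OPTIONS --safe #-}
-- For p := !((a ⇒ b) ∧ (b ⇒ a)), the relation "p · x ≤ y and p · y ≤ x" is a
-- congruence: p is a multiplicative idempotent below 𝟏 and !-closed, which makes
-- "p · x ≤ y" a preorder compatible with every operation. It contains (a , b)
-- since p ≤ a ⇒ b and p ≤ b ⇒ a. Conversely, any congruence containing (a , b)
-- identifies (a ⇒ b) ∧ (b ⇒ a) with (b ⇒ b) ∧ (b ⇒ b) ≥ 𝟏, hence p with 𝟏 and
-- p · x with x; so p · c ≤ d gives c ~ p · c = p · c ∧ d ~ c ∧ d. The
-- congruence generated by (a , b) is thus cut out by the two equations
-- p · c ∧ d = p · c and p · d ∧ c = p · d.
module Submission where

open import Defs using (Girale; Term; GiralesHaveEDPC; InCg; IsCongruence)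
open import Level using (Level)
open import Data.Fin using (Fin; zero; suc)
open import Data.Product using (_×_; _,_)
open import Function.Bundles using (_⇔_; mk⇔; Equivalence)
open import Relation.Binary.Core using (Rel)
open import Relation.Binary.PropositionalEquality
  using (_≡_; sym; trans; cong; subst; subst₂)
open import Relation.Binary.Structures using (IsEquivalence)
open import Relation.Binary.Bundles using (Preorder)
import Relation.Binary.PropositionalEquality as ≡
open import Algebra.Lattice.Bundles using (Lattice)
open import Algebra.Lattice.Structures using (IsLattice)
open import Algebra.Lattice.Properties.Lattice using (∧-idem; ∨-∧-orderTheoreticLattice)
import Relation.Binary.Lattice.Bundles as OrderTheoretic
open import Algebra.Structures using (IsCommutativeMonoid)
open import Algebra.Bundles using (CommutativeSemigroup)
open import Algebra.Properties.CommutativeSemigroup using (interchange)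

module GiraleProperties {ℓ : Level} (G : Girale ℓ) where
  open Girale G
  open IsLattice isLattice using (∧-comm)
  open IsCommutativeMonoid isCommutativeMonoid using (assoc; identityˡ; comm)

  private
    lattice : Lattice ℓ ℓ
    lattice = record { isLattice = isLattice }

    ·-commutativeSemigroup : CommutativeSemigroup ℓ ℓ
    ·-commutativeSemigroup = record { isCommutativeSemigroup = isCommutativeSemigroup }
      where open IsCommutativeMonoid isCommutativeMonoid using (isCommutativeSemigroup)

    -- The library's natural order is x ≡ x ∧ y, the symmetric form of _≤_.
    module O = OrderTheoretic.Lattice (∨-∧-orderTheoreticLattice lattice)

  ≤-refl : ∀ {x} → x ≤ x
  ≤-refl = sym O.refl

  ≤-trans : ∀ {x y z} → x ≤ y → y ≤ z → x ≤ z
  ≤-trans x≤y y≤z = sym (O.trans (sym x≤y) (sym y≤z))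

  ≤-antisym : ∀ {x y} → x ≤ y → y ≤ x → x ≡ y
  ≤-antisym x≤y y≤x = O.antisym (sym x≤y) (sym y≤x)

  x∧y≤x : ∀ x y → (x ∧ y) ≤ x
  x∧y≤x x y = sym (O.x∧y≤x x y)

  x∧y≤y : ∀ x y → (x ∧ y) ≤ y
  x∧y≤y x y = sym (O.x∧y≤y x y)

  ∧-greatest : ∀ {x y z} → x ≤ y → x ≤ z → x ≤ (y ∧ z)
  ∧-greatest x≤y x≤z = sym (O.∧-greatest (sym x≤y) (sym x≤z))

  x≤x∨y : ∀ x y → x ≤ (x ∨ y)
  x≤x∨y x y = sym (O.x≤x∨y x y)

  y≤x∨y : ∀ x y → y ≤ (x ∨ y)
  y≤x∨y x y = sym (O.y≤x∨y x y)

  ∨-least : ∀ {x y z} → x ≤ z → y ≤ z → (x ∨ y) ≤ z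
  ∨-least x≤z y≤z = sym (O.∨-least (sym x≤z) (sym y≤z))

  ≤-preorder : Preorder ℓ ℓ ℓ
  ≤-preorder = record
    { _≈_ = _≡_
    ; _≲_ = _≤_
    ; isPreorder = record
      { isEquivalence = ≡.isEquivalence
      ; reflexive = λ { ≡.refl → ≤-refl }
      ; trans = ≤-trans
      }
    }

  open import Relation.Binary.Reasoning.Preorder ≤-preorder

  curry : ∀ {x y z} → (x · y) ≤ z → x ≤ (y ⇒ z)
  curry = Equivalence.to (residuation _ _ _)

  uncurry : ∀ {x y z} → x ≤ (y ⇒ z) → (x · y) ≤ z
  uncurry = Equivalence.from (residuation _ _ _)

  ⇒-eval : ∀ {x y} → ((x ⇒ y) · x) ≤ y
  ⇒-eval = uncurry ≤-refl

  ·-monoˡ-≤ : ∀ {x y} z → x ≤ y → (x · z) ≤ (y · z)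
  ·-monoˡ-≤ z x≤y = uncurry (≤-trans x≤y (curry ≤-refl))

  ·-monoʳ-≤ : ∀ {x y} z → x ≤ y → (z · x) ≤ (z · y)
  ·-monoʳ-≤ {x} {y} z x≤y = subst₂ _≤_ (comm x z) (comm y z) (·-monoˡ-≤ z x≤y)

  𝟏≤x⇒x : ∀ x → 𝟏 ≤ (x ⇒ x)
  𝟏≤x⇒x x = curry (subst (_≤ x) (sym (identityˡ x)) ≤-refl)

  !x≤x : ∀ x → ! x ≤ x
  !x≤x x = ≤-trans (G2 x) (x∧y≤x x 𝟏)

  !x≤𝟏 : ∀ x → ! x ≤ 𝟏
  !x≤𝟏 x = ≤-trans (G2 x) (x∧y≤y x 𝟏)

  !x·y≤y : ∀ x y → (! x · y) ≤ y
  !x·y≤y x y = subst ((! x · y) ≤_) (identityˡ y) (·-monoˡ-≤ y (!x≤𝟏 x))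

  !-idem-· : ∀ x → ! x · ! x ≡ ! x
  !-idem-· x = trans (G3 x x) (cong ! (∧-idem lattice x))

  !-promotion : ∀ {x y} → ! x ≤ y → ! x ≤ ! y
  !-promotion {x} {y} !x≤y = subst (_≤ ! y) (sym !x≡!!x·!y) (!x·y≤y (! x) (! y))
    where
    !x≡!!x·!y : ! x ≡ ! (! x) · ! y
    !x≡!!x·!y = trans (sym (G4 x)) (trans (cong ! (sym !x≤y)) (sym (G3 (! x) y)))

  !-mono-≤ : ∀ {x y} → x ≤ y → ! x ≤ ! y
  !-mono-≤ {x} x≤y = !-promotion (≤-trans (!x≤x x) x≤y)

  !-≥𝟏 : ∀ {x} → 𝟏 ≤ x → ! x ≡ 𝟏
  !-≥𝟏 {x} 𝟏≤x = ≤-antisym (!x≤𝟏 x) (subst (_≤ ! x) G1 (!-mono-≤ 𝟏≤x))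

  module !Congruence (u : Carrier) where
    p : Carrier
    p = ! u

    _≤ₚ_ : Rel Carrier ℓ
    x ≤ₚ y = (p · x) ≤ y

    _≈ₚ_ : Rel Carrier ℓ
    x ≈ₚ y = x ≤ₚ y × y ≤ₚ x

    p·-distrib-· : ∀ x y → ((p · x) · (p · y)) ≡ (p · (x · y))
    p·-distrib-· x y = trans (interchange ·-commutativeSemigroup p x p y) (cong (_· (x · y)) (!-idem-· u))

    p·p·x≡p·x : ∀ x → (p · (p · x)) ≡ (p · x)
    p·p·x≡p·x x = trans (sym (assoc p p x)) (cong (_· x) (!-idem-· u))

    ≤ₚ⇒≤p⇒ : ∀ {x y} → x ≤ₚ y → x ≤ (p ⇒ y)
    ≤ₚ⇒≤p⇒ {x} {y} x≤ₚy = curry (subst (_≤ y) (comm p x) x≤ₚy)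

    ≤p⇒⇒≤ₚ : ∀ {x y} → x ≤ (p ⇒ y) → x ≤ₚ y
    ≤p⇒⇒≤ₚ {x} {y} x≤p⇒y = subst (_≤ y) (comm x p) (uncurry x≤p⇒y)

    ≤ₚ-refl : ∀ {x} → x ≤ₚ x
    ≤ₚ-refl {x} = !x·y≤y u x

    ≤ₚ-trans : ∀ {x y z} → x ≤ₚ y → y ≤ₚ z → x ≤ₚ z
    ≤ₚ-trans {x} {y} {z} x≤ₚy y≤ₚz = begin
      p · x        ≡⟨ sym (p·p·x≡p·x x) ⟩
      p · (p · x)  ≲⟨ ·-monoʳ-≤ p x≤ₚy ⟩
      p · y        ≲⟨ y≤ₚz ⟩
      z            ∎

    ∧-mono-≤ₚ : ∀ {x x′ y y′} → x ≤ₚ x′ → y ≤ₚ y′ → (x ∧ y) ≤ₚ (x′ ∧ y′)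
    ∧-mono-≤ₚ {x} {x′} {y} {y′} x≤ₚx′ y≤ₚy′ = ∧-greatest
      (≤-trans (·-monoʳ-≤ p (x∧y≤x x y)) x≤ₚx′)
      (≤-trans (·-monoʳ-≤ p (x∧y≤y x y)) y≤ₚy′)

    ∨-mono-≤ₚ : ∀ {x x′ y y′} → x ≤ₚ x′ → y ≤ₚ y′ → (x ∨ y) ≤ₚ (x′ ∨ y′)
    ∨-mono-≤ₚ {x} {x′} {y} {y′} x≤ₚx′ y≤ₚy′ = ≤p⇒⇒≤ₚ (∨-least
      (≤ₚ⇒≤p⇒ (≤-trans x≤ₚx′ (x≤x∨y x′ y′)))
      (≤ₚ⇒≤p⇒ (≤-trans y≤ₚy′ (y≤x∨y x′ y′))))

    ·-mono-≤ₚ : ∀ {x x′ y y′} → x ≤ₚ x′ → y ≤ₚ y′ → (x · y) ≤ₚ (x′ · y′)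
    ·-mono-≤ₚ {x} {x′} {y} {y′} x≤ₚx′ y≤ₚy′ = begin
      p · (x · y)        ≡⟨ sym (p·-distrib-· x y) ⟩
      (p · x) · (p · y)  ≲⟨ ·-monoˡ-≤ (p · y) x≤ₚx′ ⟩
      x′ · (p · y)       ≲⟨ ·-monoʳ-≤ x′ y≤ₚy′ ⟩
      x′ · y′            ∎

    ⇒-mono-≤ₚ : ∀ {x x′ y y′} → x′ ≤ₚ x → y ≤ₚ y′ → (x ⇒ y) ≤ₚ (x′ ⇒ y′)
    ⇒-mono-≤ₚ {x} {x′} {y} {y′} x′≤ₚx y≤ₚy′ = curry (begin
      (p · (x ⇒ y)) · x′        ≡⟨ assoc p (x ⇒ y) x′ ⟩
      p · ((x ⇒ y) · x′)        ≡⟨ sym (p·-distrib-· (x ⇒ y) x′) ⟩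
      (p · (x ⇒ y)) · (p · x′)  ≲⟨ ·-monoʳ-≤ (p · (x ⇒ y)) x′≤ₚx ⟩
      (p · (x ⇒ y)) · x         ≡⟨ assoc p (x ⇒ y) x ⟩
      p · ((x ⇒ y) · x)         ≲⟨ ·-monoʳ-≤ p ⇒-eval ⟩
      p · y                     ≲⟨ y≤ₚy′ ⟩
      y′                        ∎)

    !-mono-≤ₚ : ∀ {x x′} → x ≤ₚ x′ → (! x) ≤ₚ (! x′)
    !-mono-≤ₚ {x} {x′} x≤ₚx′ = subst (_≤ ! x′) (sym (G3 u x)) (!-promotion (begin
      ! (u ∧ x)  ≡⟨ sym (G3 u x) ⟩
      p · ! x    ≲⟨ ·-monoʳ-≤ p (!x≤x x) ⟩
      p · x      ≲⟨ x≤ₚx′ ⟩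
      x′         ∎))

    ≈ₚ-isCongruence : IsCongruence G _≈ₚ_
    ≈ₚ-isCongruence = record
      { isEquivalence = record
        { refl = ≤ₚ-refl , ≤ₚ-refl
        ; sym = λ (x≤ₚy , y≤ₚx) → y≤ₚx , x≤ₚy
        ; trans = λ (x≤ₚy , y≤ₚx) (y≤ₚz , z≤ₚy) → ≤ₚ-trans x≤ₚy y≤ₚz , ≤ₚ-trans z≤ₚy y≤ₚx
        }
      ; ∨-compat = λ (f , f′) (g , g′) → ∨-mono-≤ₚ f g , ∨-mono-≤ₚ f′ g′
      ; ∧-compat = λ (f , f′) (g , g′) → ∧-mono-≤ₚ f g , ∧-mono-≤ₚ f′ g′
      ; ⇒-compat = λ (f , f′) (g , g′) → ⇒-mono-≤ₚ f′ g , ⇒-mono-≤ₚ f g′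
      ; ·-compat = λ (f , f′) (g , g′) → ·-mono-≤ₚ f g , ·-mono-≤ₚ f′ g′
      ; !-compat = λ (f , f′) → !-mono-≤ₚ f , !-mono-≤ₚ f′
      }

  biresiduum : Carrier → Carrier → Carrier
  biresiduum a b = (a ⇒ b) ∧ (b ⇒ a)

  module PrincipalCongruence (a b : Carrier) where
    open !Congruence (biresiduum a b) public

    a≈ₚb : a ≈ₚ b
    a≈ₚb = uncurry (≤-trans (!x≤x _) (x∧y≤x _ _)) , uncurry (≤-trans (!x≤x _) (x∧y≤y _ _))

    module _ {θ : Rel Carrier ℓ} (θ-isCongruence : IsCongruence G θ) (θab : θ a b) where
      open IsCongruence θ-isCongruence
      open IsEquivalence isEquivalence renaming (refl to θ-refl; sym to θ-sym; trans to θ-trans)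

      θp𝟏 : θ p 𝟏
      θp𝟏 = subst (θ p) !biresiduum-b-b≡𝟏
        (!-compat (∧-compat (⇒-compat θab θ-refl) (⇒-compat θ-refl θab)))
        where
        !biresiduum-b-b≡𝟏 : ! (biresiduum b b) ≡ 𝟏
        !biresiduum-b-b≡𝟏 = !-≥𝟏 (∧-greatest (𝟏≤x⇒x b) (𝟏≤x⇒x b))

      θp·x-x : ∀ x → θ (p · x) x
      θp·x-x x = subst (θ (p · x)) (identityˡ x) (·-compat θp𝟏 θ-refl)

      ≤ₚ⇒θ-∧ : ∀ {x y} → x ≤ₚ y → θ x (x ∧ y)
      ≤ₚ⇒θ-∧ {x} {y} x≤ₚy = θ-trans (θ-sym (θp·x-x x))
        (subst (λ z → θ z (x ∧ y)) x≤ₚy (∧-compat (θp·x-x x) θ-refl))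

      ≈ₚ⇒θ : ∀ {c d} → c ≈ₚ d → θ c d
      ≈ₚ⇒θ {c} {d} (c≤ₚd , d≤ₚc) = θ-trans (≤ₚ⇒θ-∧ c≤ₚd)
        (subst (λ z → θ z d) (∧-comm d c) (θ-sym (≤ₚ⇒θ-∧ d≤ₚc)))

    InCg⇔≈ₚ : ∀ c d → InCg G a b c d ⇔ (c ≈ₚ d)
    InCg⇔≈ₚ c d = mk⇔ (λ c~d → c~d _≈ₚ_ ≈ₚ-isCongruence a≈ₚb)
                      (λ c≈ₚd θ θ-isCongruence θab → ≈ₚ⇒θ θ-isCongruence θab c≈ₚd)

module EDPCTerms where
  open Term

  x₀ x₁ x₂ x₃ p : Term 4
  x₀ = var zero
  x₁ = var (suc zero)
  x₂ = var (suc (suc zero))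
  x₃ = var (suc (suc (suc zero)))
  p = ! ((x₀ ⇒ x₁) ∧ (x₁ ⇒ x₀))

  s t : Fin 2 → Term 4
  s zero = (p · x₂) ∧ x₃
  s (suc zero) = (p · x₃) ∧ x₂
  t zero = p · x₂
  t (suc zero) = p · x₃

mainTheorem15 : GiralesHaveEDPC
mainTheorem15 = record
  { k = 2
  ; s = EDPCTerms.s
  ; t = EDPCTerms.t
  ; defines = λ G a b c d →
      let open GiraleProperties.PrincipalCongruence G a b
      in mk⇔ (λ c~d → pairToFin (Equivalence.to (InCg⇔≈ₚ c d) c~d))
             (λ eqs → Equivalence.from (InCg⇔≈ₚ c d) (eqs zero , eqs (suc zero)))
  }
  where
  pairToFin : ∀ {ℓ} {P : Fin 2 → Set ℓ} → P zero × P (suc zero) → (i : Fin 2) → P i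
  pairToFin (p₀ , p₁) zero = p₀
  pairToFin (p₀ , p₁) (suc zero) = p₁
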